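{- Let $p$ be an odd prime, $\alpha$ a positive integer, and $k\geq 3$ an odd integer. Let $S_k(n):=1^k+2^k+\cdots+n^k$. If $p-1\nmid (k-1)$, then \[ (p^\alpha)^2 \mid S_k(p^\alpha). \] -}

module Defs where

open import Data.Nat using (ℕ; zero; suc; _+_; _^_)

S : ℕ → ℕ → ℕ
S k zero    = 0
S k (suc n) = S k n + suc n ^ k

module Submission where

-- Write T_m(n) = 0^m + 1^m + ... + (n-1)^m.  For a prime p with p - 1 ∤ m, p ∣ T_m(p): for
-- m < p - 1 by induction on m, using  Σ_{j ≤ m} C(m+1, j) T_j(n) = n^(m+1)  in which the top
-- coefficient m + 1 is a unit mod p; in general Fermat's little theorem reduces m modulo p - 1.
-- This lifts from a = p^β to p a: writing i = t a + r, (r + t a)^(m+1) ≡ r^(m+1) + (m+1) r^m t a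
-- modulo p a, and Σ_{t<p} t is a multiple of p because p is odd.  Finally, for odd k and
-- Q = p^α, pairing i with Q - i gives 2 S_k(Q) ≡ k Q T_{k-1}(Q+1) ≡ 0 modulo Q², and Q is odd.

module Parity where

  open import Data.Nat.Base using (zero; suc; _*_; _^_; s≤s)
  open import Data.Nat.DivMod using (_%_; _/_; m%n<n; m≡m%n+[m/n]*n)
  open import Data.Nat.Divisibility using (_∣_; divides)
  open import Data.Nat.Primality using (euclidsLemma; prime[2]; prime⇒irreducible)
  open import Data.Nat.Coprimality using (Coprime)
  open import Data.Product using (∃-syntax; _,_)
  open import Data.Sum using (inj₁; inj₂)
  open import Relation.Binary.PropositionalEquality using (_≡_; refl)
  open import Relation.Nullary using (¬_; contradiction)

  odd⇒≡1+h*2 : ∀ {n} → ¬ (2 ∣ n) → ∃[ h ] n ≡ suc (h * 2)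
  odd⇒≡1+h*2 {n} 2∤n with n % 2 | m%n<n n 2 | m≡m%n+[m/n]*n n 2
  ... | zero        | _               | n≡[n/2]*2   = contradiction (divides (n / 2) n≡[n/2]*2) 2∤n
  ... | suc zero    | _               | n≡1+[n/2]*2 = n / 2 , n≡1+[n/2]*2
  ... | suc (suc _) | s≤s (s≤s ())    | _

  odd-* : ∀ {m n} → ¬ (2 ∣ m) → ¬ (2 ∣ n) → ¬ (2 ∣ m * n)
  odd-* {m} {n} 2∤m 2∤n 2∣mn with euclidsLemma m n prime[2] 2∣mn
  ... | inj₁ 2∣m = 2∤m 2∣m
  ... | inj₂ 2∣n = 2∤n 2∣n

  odd⇒coprime-2 : ∀ {n} → ¬ (2 ∣ n) → Coprime n 2
  odd⇒coprime-2 2∤n (d∣n , d∣2) with prime⇒irreducible prime[2] d∣2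
  ... | inj₁ d≡1 = d≡1
  ... | inj₂ refl = contradiction d∣n 2∤n

  odd-^ : ∀ {m} → ¬ (2 ∣ m) → ∀ k → ¬ (2 ∣ m ^ k)
  odd-^ 2∤m zero    (divides (suc q) ())
  odd-^ 2∤m (suc k) = odd-* 2∤m (odd-^ 2∤m k)

module BinomialCoefficients where

  open import Data.Nat.Base using (zero; suc; _<_; _≤_; _∸_; _*_; _!; s≤s; NonZero; nonTrivial⇒n>1)
  open import Data.Nat.Properties using (m∸n≤m; m+n∸n≡m; n≤1+n; <⇒≤; <-irrefl; <⇒≱; m≤n⇒m≤1+n; _!*_!≢0)
  open import Data.Nat.Combinatorics using (_C_; nCk≡n!/k![n-k]!; k![n∸k]!∣n!; nCk≡nC[n∸k]; nC1≡n)
  open import Data.Nat.DivMod using (m/n*n≡m)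
  open import Data.Nat.Divisibility using (_∣_; ∣⇒≤; ∣1⇒≡1; m∣m*n)
  open import Data.Nat.Primality using (Prime; euclidsLemma; prime⇒nonTrivial)
  open import Data.Sum using (inj₁; inj₂)
  open import Relation.Binary.PropositionalEquality using (_≡_; refl; sym; trans; cong; subst)
  open import Relation.Nullary using (contradiction)

  nCk*k!*[n∸k]!≡n! : ∀ {n k} → k ≤ n → (n C k) * (k ! * (n ∸ k) !) ≡ n !
  nCk*k!*[n∸k]!≡n! {n} {k} k≤n =
    trans (cong (_* (k ! * (n ∸ k) !)) (nCk≡n!/k![n-k]! k≤n)) (m/n*n≡m (k![n∸k]!∣n! k≤n))
    where
    instance
      k!*[n∸k]!≢0 : NonZero (k ! * (n ∸ k) !)
      k!*[n∸k]!≢0 = k !* (n ∸ k) !≢0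

  [1+n]Cn≡1+n : ∀ n → suc n C n ≡ suc n
  [1+n]Cn≡1+n n =
    trans (nCk≡nC[n∸k] (n≤1+n n)) (trans (cong (suc n C_) (m+n∸n≡m 1 n)) (nC1≡n (suc n)))

  prime∣n!⇒p≤n : ∀ {p} → Prime p → ∀ n → p ∣ n ! → p ≤ n
  prime∣n!⇒p≤n {p} prime-p zero p∣1 =
    contradiction (subst (1 <_) (∣1⇒≡1 p∣1) (nonTrivial⇒n>1 p {{prime⇒nonTrivial prime-p}}))
                  (<-irrefl refl)
  prime∣n!⇒p≤n prime-p (suc n) p∣n! with euclidsLemma (suc n) (n !) prime-p p∣n!
  ... | inj₁ p∣1+n = ∣⇒≤ p∣1+n
  ... | inj₂ p∣n!′ = m≤n⇒m≤1+n (prime∣n!⇒p≤n prime-p n p∣n!′)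

  prime∣pCk : ∀ {p k} → Prime p → 0 < k → k < p → p ∣ p C k
  prime∣pCk {suc q} {suc j} prime-p _ k<p
    with euclidsLemma (suc q C suc j) (suc j ! * (q ∸ j) !) prime-p
           (subst (suc q ∣_) (sym (nCk*k!*[n∸k]!≡n! (<⇒≤ k<p))) (m∣m*n (q !)))
  ... | inj₁ p∣C = p∣C
  ... | inj₂ p∣k!*[p∸k]! with euclidsLemma (suc j !) ((q ∸ j) !) prime-p p∣k!*[p∸k]!
  ...   | inj₁ p∣k! = contradiction (prime∣n!⇒p≤n prime-p (suc j) p∣k!) (<⇒≱ k<p)
  ...   | inj₂ p∣[p∸k]! =
    contradiction (prime∣n!⇒p≤n prime-p (q ∸ j) p∣[p∸k]!) (<⇒≱ (s≤s (m∸n≤m q j)))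

module Congruence where

  open import Data.Nat as ℕ using ()
  open import Data.Nat.Divisibility as ℕ using ()
  open import Data.Nat.Primality using (Prime; euclidsLemma)
  open import Data.Integer.Base as ℤ using (ℤ; +_; 0ℤ; _+_; _-_; _*_; -_; _^_)
  open import Data.Integer.Properties using (+-inverseʳ; abs-*)
  open import Data.Integer.Divisibility.Signed
    using (_∣_; divides; ∣-trans; ∣m∣n⇒∣m+n; ∣n⇒∣m*n; ∣m⇒∣m*n; ∣⇒∣ᵤ; ∣ᵤ⇒∣)
  open import Data.Integer.Tactic.RingSolver using (solve-∀)
  open import Data.Sum using (_⊎_; inj₁; inj₂)
  open import Relation.Binary.PropositionalEquality using (_≡_; refl; sym; trans; cong; subst)
  open import Relation.Nullary using (¬_; contradiction)

  -- A record rather than a synonym for n ∣ a - b, so that a, b and n are inferable.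
  infix 4 _≡_mod_
  record _≡_mod_ (a b n : ℤ) : Set where
    constructor from∣
    field ∣-difference : n ∣ a - b
  open _≡_mod_ public

  mod-refl : ∀ {n} a → a ≡ a mod n
  mod-refl {n} a = from∣ (divides 0ℤ (subst (_≡ 0ℤ * n) (sym (+-inverseʳ a)) refl))

  mod-reflexive : ∀ {n a b} → a ≡ b → a ≡ b mod n
  mod-reflexive {a = a} refl = mod-refl a

  mod-trans : ∀ {n a b c} → a ≡ b mod n → b ≡ c mod n → a ≡ c mod n
  mod-trans {a = a} {b} {c} (from∣ n∣a-b) (from∣ n∣b-c) =
    from∣ (subst (_ ∣_) (chain a b c) (∣m∣n⇒∣m+n n∣a-b n∣b-c))
    where
    chain : ∀ a b c → (a - b) + (b - c) ≡ a - c
    chain = solve-∀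

  +-cong-mod : ∀ {n a b c d} → a ≡ b mod n → c ≡ d mod n → a + c ≡ b + d mod n
  +-cong-mod {a = a} {b} {c} {d} (from∣ n∣a-b) (from∣ n∣c-d) =
    from∣ (subst (_ ∣_) (regroup a b c d) (∣m∣n⇒∣m+n n∣a-b n∣c-d))
    where
    regroup : ∀ a b c d → (a - b) + (c - d) ≡ (a + c) - (b + d)
    regroup = solve-∀

  *-cong-mod : ∀ {n a b c d} → a ≡ b mod n → c ≡ d mod n → a * c ≡ b * d mod n
  *-cong-mod {a = a} {b} {c} {d} (from∣ n∣a-b) (from∣ n∣c-d) =
    from∣ (subst (_ ∣_) (regroup a b c d) (∣m∣n⇒∣m+n (∣m⇒∣m*n c n∣a-b) (∣n⇒∣m*n b n∣c-d)))
    where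
    regroup : ∀ a b c d → (a - b) * c + b * (c - d) ≡ a * c - b * d
    regroup = solve-∀

  ^-cong-mod : ∀ {n a b} → a ≡ b mod n → ∀ k → a ^ k ≡ b ^ k mod n
  ^-cong-mod a≡b ℕ.zero    = mod-refl _
  ^-cong-mod a≡b (ℕ.suc k) = *-cong-mod a≡b (^-cong-mod a≡b k)

  mod-∣ : ∀ {m n a b} → m ∣ n → a ≡ b mod n → a ≡ b mod m
  mod-∣ m∣n (from∣ n∣a-b) = from∣ (∣-trans m∣n n∣a-b)

  *-monoˡ-∣ : ∀ {a b} c → a ∣ b → c * a ∣ c * b
  *-monoˡ-∣ {a} c (divides q b≡qa) = divides q (trans (cong (c *_) b≡qa) (rotate c q a))
    where
    rotate : ∀ c q a → c * (q * a) ≡ q * (c * a)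
    rotate = solve-∀

  ∣⇒+≡mod : ∀ {n x} a → n ∣ x → a + x ≡ a mod n
  ∣⇒+≡mod {n} {x} a n∣x = from∣ (subst (n ∣_) (cancel a x) n∣x)
    where
    cancel : ∀ a x → x ≡ (a + x) - a
    cancel = solve-∀

  ∣-resp-≡mod : ∀ {n a b} → a ≡ b mod n → n ∣ b → n ∣ a
  ∣-resp-≡mod {n} {a} {b} (from∣ n∣a-b) n∣b = subst (n ∣_) (cancel a b) (∣m∣n⇒∣m+n n∣a-b n∣b)
    where
    cancel : ∀ a b → (a - b) + b ≡ a
    cancel = solve-∀

  prime∣*⇒∣⊎∣ : ∀ {p} → Prime p → ∀ a b → + p ∣ a * b → + p ∣ a ⊎ + p ∣ b
  prime∣*⇒∣⊎∣ prime-p a b p∣ab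
    with euclidsLemma ℤ.∣ a ∣ ℤ.∣ b ∣ prime-p (subst (_ ℕ.∣_) (abs-* a b) (∣⇒∣ᵤ p∣ab))
  ... | inj₁ p∣a = inj₁ (∣ᵤ⇒∣ p∣a)
  ... | inj₂ p∣b = inj₂ (∣ᵤ⇒∣ p∣b)

  prime-cancelˡ : ∀ {p a b} → Prime p → ¬ (p ℕ.∣ ℤ.∣ a ∣) → + p ∣ a * b → + p ∣ b
  prime-cancelˡ {a = a} {b} prime-p p∤a p∣ab with prime∣*⇒∣⊎∣ prime-p a b p∣ab
  ... | inj₁ p∣a = contradiction (∣⇒∣ᵤ p∣a) p∤a
  ... | inj₂ p∣b = p∣b

module FiniteSums where

  open import Data.Nat as ℕ using (ℕ; zero; suc; _<_; _∸_)
  open import Data.Nat.Properties as ℕ using (n<1+n; m<n⇒m<1+n)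
  open import Data.Integer.Base using (ℤ; +_; 0ℤ; 1ℤ; _+_; _-_; _*_)
  open import Data.Integer.Properties
    using (+-identityʳ; +-inverseʳ; +-comm; +-assoc; *-zeroʳ; *-distribˡ-+; *-distribʳ-+; pos-+)
  open import Data.Integer.Divisibility.Signed using (_∣_; divides; ∣m∣n⇒∣m+n)
  open import Data.Integer.Tactic.RingSolver using (solve-∀)
  open import Relation.Binary.PropositionalEquality
  open Congruence using (_≡_mod_; mod-refl; +-cong-mod)

  ∑< : ℕ → (ℕ → ℤ) → ℤ
  ∑< zero    f = 0ℤ
  ∑< (suc n) f = ∑< n f + f n

  infixl 10 ∑<
  syntax ∑< n (λ i → e) = ∑[ i < n ] e

  ∑-cong : ∀ {f g} n → (∀ i → i < n → f i ≡ g i) → ∑< n f ≡ ∑< n g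
  ∑-cong zero    f≡g = refl
  ∑-cong (suc n) f≡g = cong₂ _+_ (∑-cong n (λ i i<n → f≡g i (m<n⇒m<1+n i<n))) (f≡g n (n<1+n n))

  ∑-cong-mod : ∀ {f g d} n → (∀ i → i < n → f i ≡ g i mod d) → ∑< n f ≡ ∑< n g mod d
  ∑-cong-mod zero    f≡g = mod-refl 0ℤ
  ∑-cong-mod (suc n) f≡g =
    +-cong-mod (∑-cong-mod n (λ i i<n → f≡g i (m<n⇒m<1+n i<n))) (f≡g n (n<1+n n))

  ∣-∑ : ∀ {f d} n → (∀ i → i < n → d ∣ f i) → d ∣ ∑< n f
  ∣-∑ zero    d∣f = divides 0ℤ refl
  ∣-∑ (suc n) d∣f = ∣m∣n⇒∣m+n (∣-∑ n (λ i i<n → d∣f i (m<n⇒m<1+n i<n))) (d∣f n (n<1+n n))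

  ∑-const : ∀ n c → ∑[ i < n ] c ≡ + n * c
  ∑-const zero    c = refl
  ∑-const (suc n) c = begin
    ∑[ i < n ] c + c   ≡⟨ cong (_+ c) (∑-const n c) ⟩
    + n * c + c        ≡⟨ add-one (+ n) c ⟩
    (1ℤ + + n) * c     ≡⟨ cong (_* c) (pos-+ 1 n) ⟨
    + suc n * c        ∎
    where
    open ≡-Reasoning
    add-one : ∀ n c → n * c + c ≡ (1ℤ + n) * c
    add-one = solve-∀

  ∑-zero : ∀ n → ∑[ i < n ] 0ℤ ≡ 0ℤ
  ∑-zero zero    = refl
  ∑-zero (suc n) = cong (_+ 0ℤ) (∑-zero n)

  ∑-distrib-+ : ∀ n (f g : ℕ → ℤ) → ∑[ i < n ] (f i + g i) ≡ ∑< n f + ∑< n g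
  ∑-distrib-+ zero    f g = refl
  ∑-distrib-+ (suc n) f g =
    trans (cong (_+ (f n + g n)) (∑-distrib-+ n f g)) (interchange (∑< n f) (∑< n g) (f n) (g n))
    where
    interchange : ∀ a b c d → (a + b) + (c + d) ≡ (a + c) + (b + d)
    interchange = solve-∀

  *-distribˡ-∑ : ∀ c n (f : ℕ → ℤ) → c * ∑< n f ≡ ∑[ i < n ] (c * f i)
  *-distribˡ-∑ c zero    f = *-zeroʳ c
  *-distribˡ-∑ c (suc n) f =
    trans (*-distribˡ-+ c (∑< n f) (f n)) (cong (_+ c * f n) (*-distribˡ-∑ c n f))

  *-distribʳ-∑ : ∀ c n (f : ℕ → ℤ) → ∑< n f * c ≡ ∑[ i < n ] (f i * c)
  *-distribʳ-∑ c zero    f = refl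
  *-distribʳ-∑ c (suc n) f =
    trans (*-distribʳ-+ c (∑< n f) (f n)) (cong (_+ f n * c) (*-distribʳ-∑ c n f))

  ∑-head : ∀ n (f : ℕ → ℤ) → ∑< (suc n) f ≡ f 0 + ∑[ i < n ] f (suc i)
  ∑-head zero    f = +-comm 0ℤ (f 0)
  ∑-head (suc n) f = trans (cong (_+ f (suc n)) (∑-head n f)) (+-assoc (f 0) _ (f (suc n)))

  ∑-split : ∀ m n (f : ℕ → ℤ) → ∑< (m ℕ.+ n) f ≡ ∑< m f + ∑[ i < n ] f (m ℕ.+ i)
  ∑-split m zero    f = trans (cong (λ k → ∑< k f) (ℕ.+-identityʳ m)) (sym (+-identityʳ _))
  ∑-split m (suc n) f = begin
    ∑< (m ℕ.+ suc n) f                                  ≡⟨ cong (λ k → ∑< k f) (ℕ.+-suc m n) ⟩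
    ∑< (m ℕ.+ n) f + f (m ℕ.+ n)                         ≡⟨ cong (_+ f (m ℕ.+ n)) (∑-split m n f) ⟩
    ∑< m f + ∑[ i < n ] f (m ℕ.+ i) + f (m ℕ.+ n)        ≡⟨ +-assoc (∑< m f) _ _ ⟩
    ∑< m f + ∑[ i < suc n ] f (m ℕ.+ i)                  ∎
    where open ≡-Reasoning

  ∑-blocks : ∀ b a (f : ℕ → ℤ) → ∑< (b ℕ.* a) f ≡ ∑[ t < b ] ∑[ r < a ] f (t ℕ.* a ℕ.+ r)
  ∑-blocks zero    a f = refl
  ∑-blocks (suc b) a f = begin
    ∑< (a ℕ.+ b ℕ.* a) f                                 ≡⟨ cong (λ k → ∑< k f) (ℕ.+-comm a (b ℕ.* a)) ⟩
    ∑< (b ℕ.* a ℕ.+ a) f                                 ≡⟨ ∑-split (b ℕ.* a) a f ⟩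
    ∑< (b ℕ.* a) f + ∑[ r < a ] f (b ℕ.* a ℕ.+ r)
      ≡⟨ cong (_+ ∑[ r < a ] f (b ℕ.* a ℕ.+ r)) (∑-blocks b a f) ⟩
    ∑[ t < suc b ] ∑[ r < a ] f (t ℕ.* a ℕ.+ r)           ∎
    where open ≡-Reasoning

  ∑-comm : ∀ m n (f : ℕ → ℕ → ℤ) → ∑[ i < n ] ∑[ j < m ] f i j ≡ ∑[ j < m ] ∑[ i < n ] f i j
  ∑-comm m zero    f = sym (∑-zero m)
  ∑-comm m (suc n) f = begin
    ∑[ i < n ] ∑[ j < m ] f i j + ∑[ j < m ] f n j    ≡⟨ cong (_+ ∑[ j < m ] f n j) (∑-comm m n f) ⟩
    ∑[ j < m ] ∑[ i < n ] f i j + ∑[ j < m ] f n j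
      ≡⟨ ∑-distrib-+ m (λ j → ∑[ i < n ] f i j) (λ j → f n j) ⟨
    ∑[ j < m ] ∑[ i < suc n ] f i j                   ∎
    where open ≡-Reasoning

  ∑-reverse : ∀ n (f : ℕ → ℤ) → ∑< (suc n) f ≡ ∑[ i < suc n ] f (n ∸ i)
  ∑-reverse zero    f = refl
  ∑-reverse (suc n) f = begin
    ∑< (suc n) f + f (suc n)                  ≡⟨ cong (_+ f (suc n)) (∑-reverse n f) ⟩
    ∑[ i < suc n ] f (n ∸ i) + f (suc n)      ≡⟨ +-comm _ (f (suc n)) ⟩
    f (suc n) + ∑[ i < suc n ] f (n ∸ i)      ≡⟨ ∑-head (suc n) (λ i → f (suc n ∸ i)) ⟨
    ∑[ i < suc (suc n) ] f (suc n ∸ i)        ∎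
    where open ≡-Reasoning

  ∑-telescope : ∀ n (g : ℕ → ℤ) → ∑[ i < n ] (g (suc i) - g i) ≡ g n - g 0
  ∑-telescope zero    g = sym (+-inverseʳ (g 0))
  ∑-telescope (suc n) g =
    trans (cong (_+ (g (suc n) - g n)) (∑-telescope n g)) (collapse (g 0) (g n) (g (suc n)))
    where
    collapse : ∀ a b c → (b - a) + (c - b) ≡ c - a
    collapse = solve-∀

module Binomial where

  open import Data.Nat.Base using (ℕ; zero; suc; _<_; s≤s; z≤n)
  open import Data.Nat.Properties using (n<1+n)
  open import Data.Nat.Combinatorics using (_C_; nCn≡1; k>n⇒nCk≡0; nCk+nC[k+1]≡[n+1]C[k+1])
  open import Data.Nat.Divisibility using (>⇒∤)
  open import Data.Nat.Primality using (Prime; ¬prime[0])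
  open import Data.Integer.Base using (ℤ; +_; 0ℤ; 1ℤ; _+_; _-_; _*_; _^_)
  open import Data.Integer.Properties using (+-identityʳ; +-assoc; *-identityˡ; pos-+)
  open import Data.Integer.Divisibility.Signed using (_∣_; divides; ∣m⇒∣m*n; ∣ᵤ⇒∣)
  open import Data.Integer.Tactic.RingSolver using (solve-∀)
  open import Relation.Binary.PropositionalEquality
  open import Relation.Nullary using (contradiction)
  open Congruence
  open FiniteSums
  open BinomialCoefficients using (prime∣pCk)

  -- Summing up to any bound M > n (the surplus coefficients vanish) avoids boundary cases
  -- in the Pascal-rule induction.
  binomial-theorem : ∀ x n {M} → n < M → (1ℤ + x) ^ n ≡ ∑[ j < M ] (+ (n C j) * x ^ j)
  binomial-theorem x zero {suc M} _ = sym (begin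
    ∑[ j < suc M ] (+ (0 C j) * x ^ j)            ≡⟨ ∑-head M _ ⟩
    1ℤ + ∑[ j < M ] (+ (0 C suc j) * x ^ suc j)   ≡⟨ cong (_+_ 1ℤ) (∑-cong M λ j _ → vanish j) ⟩
    1ℤ + ∑[ j < M ] 0ℤ                            ≡⟨ cong (_+_ 1ℤ) (∑-zero M) ⟩
    1ℤ                                            ∎)
    where
    open ≡-Reasoning
    vanish : ∀ j → + (0 C suc j) * x ^ suc j ≡ 0ℤ
    vanish j = cong (λ c → + c * x ^ suc j) (k>n⇒nCk≡0 {k = suc j} (s≤s z≤n))
  binomial-theorem x (suc n) {suc M} (s≤s n<M) = begin
    (1ℤ + x) * (1ℤ + x) ^ n                      ≡⟨ cong ((1ℤ + x) *_) (binomial-theorem x n n<M) ⟩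
    (1ℤ + x) * ∑< M f                            ≡⟨ expand (∑< M f) x ⟩
    ∑< M f + x * ∑< M f                          ≡⟨ cong (_+ x * ∑< M f) extend ⟩
    ∑< (suc M) f + x * ∑< M f                    ≡⟨ cong₂ _+_ (∑-head M f) (*-distribˡ-∑ x M f) ⟩
    f 0 + ∑[ j < M ] f (suc j) + ∑[ j < M ] (x * f j)
      ≡⟨ +-assoc (f 0) (∑[ j < M ] f (suc j)) (∑[ j < M ] (x * f j)) ⟩
    f 0 + (∑[ j < M ] f (suc j) + ∑[ j < M ] (x * f j))
      ≡⟨ cong (_+_ (f 0)) (∑-distrib-+ M (λ j → f (suc j)) (λ j → x * f j)) ⟨
    f 0 + ∑[ j < M ] (f (suc j) + x * f j)       ≡⟨ cong (_+_ (f 0)) (∑-cong M λ j _ → pascal j) ⟨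
    g 0 + ∑[ j < M ] g (suc j)                   ≡⟨ ∑-head M g ⟨
    ∑< (suc M) g                                 ∎
    where
    open ≡-Reasoning
    f g : ℕ → ℤ
    f j = + (n C j) * x ^ j
    g j = + (suc n C j) * x ^ j
    expand : ∀ s x → (1ℤ + x) * s ≡ s + x * s
    expand = solve-∀
    extend : ∑< M f ≡ ∑< (suc M) f
    extend = sym (trans (cong (λ c → ∑< M f + + c * x ^ M) (k>n⇒nCk≡0 n<M)) (+-identityʳ (∑< M f)))
    pascal : ∀ j → g (suc j) ≡ f (suc j) + x * f j
    pascal j = trans (cong (λ c → + c * x ^ suc j) (sym (nCk+nC[k+1]≡[n+1]C[k+1] n j)))
                     (trans (cong (_* x ^ suc j) (pos-+ (n C j) (n C suc j)))
                            (split (+ (n C j)) (+ (n C suc j)) x (x ^ j)))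
      where
      split : ∀ a b x y → (a + b) * (x * y) ≡ b * (x * y) + x * (a * y)
      split = solve-∀

  binomial-mod-square : ∀ x y n → (x + y) ^ suc n ≡ x ^ suc n + + suc n * x ^ n * y mod y * y
  binomial-mod-square x y zero = mod-reflexive (linear x y)
    where
    linear : ∀ x y → (x + y) * 1ℤ ≡ x * 1ℤ + 1ℤ * 1ℤ * y
    linear = solve-∀
  binomial-mod-square x y (suc n) = mod-trans
    (*-cong-mod (mod-refl (x + y)) (binomial-mod-square x y n))
    (mod-trans (mod-reflexive (multiply x y (x ^ n) (+ suc n)))
               (∣⇒+≡mod (x ^ suc (suc n) + + suc (suc n) * x ^ suc n * y)
                        (divides (+ suc n * x ^ n) refl)))
    where
    multiply : ∀ x y z c → (x + y) * (x * z + c * z * y)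
                           ≡ x * (x * z) + (1ℤ + c) * (x * z) * y + c * z * (y * y)
    multiply = solve-∀

  fermat : ∀ {p} → Prime p → ∀ a → (+ a) ^ p ≡ + a mod + p
  fermat {zero}  prime-p _ = contradiction prime-p ¬prime[0]
  fermat {suc q} prime-p zero    = mod-refl 0ℤ
  fermat {suc q} prime-p (suc a) = mod-trans
    (mod-reflexive (binomial-theorem (+ a) (suc q) (n<1+n (suc q))))
    (+-cong-mod
      (mod-trans (mod-reflexive (∑-head q f)) (∣⇒+≡mod 1ℤ (∣-∑ q p∣middle)))
      (mod-trans (mod-reflexive top) (fermat prime-p a)))
    where
    f : ℕ → ℤ
    f j = + (suc q C j) * (+ a) ^ j
    p∣middle : ∀ j → j < q → + suc q ∣ f (suc j)
    p∣middle j j<q = ∣m⇒∣m*n ((+ a) ^ suc j)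
      (∣ᵤ⇒∣ {+ suc q} {+ (suc q C suc j)} (prime∣pCk prime-p (s≤s z≤n) (s≤s j<q)))
    top : f (suc q) ≡ (+ a) ^ suc q
    top = trans (cong (λ c → + c * (+ a) ^ suc q) (nCn≡1 (suc q))) (*-identityˡ ((+ a) ^ suc q))

  fermat-unit : ∀ {q} → Prime (suc q) → ∀ {a} → 0 < a → a < suc q → (+ a) ^ q ≡ 1ℤ mod + suc q
  fermat-unit {q} prime-p {suc a} _ a<p =
    from∣ (prime-cancelˡ {a = + suc a} prime-p (>⇒∤ a<p)
      (subst (+ suc q ∣_) (factor (+ suc a) ((+ suc a) ^ q)) (∣-difference (fermat prime-p (suc a)))))
    where
    factor : ∀ a z → a * z - a ≡ a * (z - 1ℤ)
    factor = solve-∀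

module PowerSums where

  open import Data.Nat as ℕ using (ℕ; zero; suc; _<_; _≤_; _∸_; s≤s; z≤n)
  open import Data.Nat.Properties as ℕ using (n<1+n; <-trans)
  open import Data.Nat.Induction using (<-rec)
  open import Data.Nat.DivMod using (_%_; _/_; m%n<n; m≡m%n+[m/n]*n)
  open import Data.Nat.Divisibility as ℕ using (>⇒∤)
  open import Data.Nat.Combinatorics using (_C_; nCn≡1)
  open import Data.Nat.Primality using (Prime; ¬prime[0]; ¬prime[1])
  open import Data.Integer.Base using (ℤ; +_; 0ℤ; 1ℤ; _+_; _-_; -_; _*_; _^_)
  open import Data.Integer.Properties
    using ( +-identityʳ; +-comm; *-identityˡ; *-identityʳ; *-comm; pos-+; pos-*
          ; ^-zeroˡ; ^-distribˡ-+-*; ^-*-assoc; m-n≡m⊖n; ⊖-≥)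
  open import Data.Integer.Divisibility.Signed
    using (_∣_; divides; ∣m∣n⇒∣m+n; ∣m+n∣m⇒∣n; ∣n⇒∣m*n; ∣⇒∣ᵤ)
  open import Data.Integer.Tactic.RingSolver using (solve-∀)
  open import Relation.Binary.PropositionalEquality
  open import Data.Product using (_,_)
  open import Relation.Nullary using (¬_; contradiction)
  open import Defs using (S)
  open Congruence
  open FiniteSums
  open BinomialCoefficients using ([1+n]Cn≡1+n)
  open Binomial
  open Parity using (odd⇒≡1+h*2)

  powerSum : ℕ → ℕ → ℤ
  powerSum m n = ∑[ i < n ] ((+ i) ^ m)

  ∑-binomial-powerSum : ∀ m n → ∑[ j < suc m ] (+ (suc m C j) * powerSum j n) ≡ (+ n) ^ suc m
  ∑-binomial-powerSum m n = begin
    ∑[ j < suc m ] (c j * powerSum j n)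
      ≡⟨ ∑-cong (suc m) (λ j _ → *-distribˡ-∑ (c j) n (λ i → (+ i) ^ j)) ⟩
    ∑[ j < suc m ] ∑[ i < n ] (c j * (+ i) ^ j)    ≡⟨ ∑-comm (suc m) n (λ i j → c j * (+ i) ^ j) ⟨
    ∑[ i < n ] ∑[ j < suc m ] (c j * (+ i) ^ j)    ≡⟨ ∑-cong n (λ i _ → difference i) ⟩
    ∑[ i < n ] (g (suc i) - g i)                   ≡⟨ ∑-telescope n g ⟩
    g n - 0ℤ                                       ≡⟨ +-identityʳ (g n) ⟩
    g n                                            ∎
    where
    open ≡-Reasoning
    c : ℕ → ℤ
    c j = + (suc m C j)
    g : ℕ → ℤ
    g i = (+ i) ^ suc m
    isolate : ∀ a b c → a ≡ b + c → b ≡ a - c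
    isolate a b c refl = sym (cancel b c)
      where
      cancel : ∀ b c → (b + c) - c ≡ b
      cancel = solve-∀
    difference : ∀ i → ∑[ j < suc m ] (c j * (+ i) ^ j) ≡ g (suc i) - g i
    difference i = isolate _ _ _ (trans (binomial-theorem (+ i) (suc m) (n<1+n (suc m)))
      (cong (_+_ (∑[ j < suc m ] (c j * (+ i) ^ j)))
            (trans (cong (λ k → + k * g i) (nCn≡1 (suc m))) (*-identityˡ (g i)))))

  prime∣powerSum-small : ∀ {p} → Prime p → ∀ m → suc m < p → + p ∣ powerSum m p
  prime∣powerSum-small {p} prime-p = <-rec (λ m → suc m < p → + p ∣ powerSum m p) step
    where
    step : ∀ m → (∀ {j} → j < m → suc j < p → + p ∣ powerSum j p) → suc m < p → + p ∣ powerSum m p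
    step m below m+1<p = prime-cancelˡ {a = + (suc m C m)} prime-p p∤[1+m]Cm p∣[1+m]Cm*powerSum
      where
      p∤[1+m]Cm : ¬ (p ℕ.∣ suc m C m)
      p∤[1+m]Cm = subst (λ x → ¬ (p ℕ.∣ x)) (sym ([1+n]Cn≡1+n m)) (>⇒∤ m+1<p)
      p∣lower : + p ∣ ∑[ j < m ] (+ (suc m C j) * powerSum j p)
      p∣lower = ∣-∑ m (λ j j<m → ∣n⇒∣m*n (+ (suc m C j)) (below j<m (<-trans (s≤s j<m) m+1<p)))
      p∣[1+m]Cm*powerSum : + p ∣ + (suc m C m) * powerSum m p
      p∣[1+m]Cm*powerSum = ∣m+n∣m⇒∣n
        (subst (+ p ∣_) (sym (∑-binomial-powerSum m p)) (divides ((+ p) ^ m) (*-comm (+ p) ((+ p) ^ m))))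
        p∣lower

  ^-reduce-mod-prime : ∀ {q} → Prime (suc q) → ∀ {i} → i < suc q → ∀ r s →
                       (+ i) ^ (suc r ℕ.+ s ℕ.* q) ≡ (+ i) ^ suc r mod + suc q
  ^-reduce-mod-prime prime-p {zero}  _   r s = mod-refl 0ℤ
  ^-reduce-mod-prime {q} prime-p {suc i} i<p r s =
    mod-trans (mod-reflexive split)
      (mod-trans (*-cong-mod (mod-refl (x ^ suc r)) (^-cong-mod (fermat-unit prime-p (s≤s z≤n) i<p) s))
                 (mod-reflexive (trans (cong (x ^ suc r *_) (^-zeroˡ s)) (*-identityʳ (x ^ suc r)))))
    where
    x : ℤ
    x = + suc i
    split : x ^ (suc r ℕ.+ s ℕ.* q) ≡ x ^ suc r * (x ^ q) ^ s
    split = trans (^-distribˡ-+-* x (suc r) (s ℕ.* q))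
                  (cong (x ^ suc r *_) (trans (cong (x ^_) (ℕ.*-comm s q)) (sym (^-*-assoc x q s))))

  prime∣powerSum : ∀ {p m} → Prime p → ¬ (p ∸ 1 ℕ.∣ m) → + p ∣ powerSum m p
  prime∣powerSum {zero}          prime-p _ = contradiction prime-p ¬prime[0]
  prime∣powerSum {suc zero}      prime-p _ = contradiction prime-p ¬prime[1]
  prime∣powerSum {suc (suc q′)} {m} prime-p q∤m
    with m % suc q′ | m%n<n m (suc q′) | m≡m%n+[m/n]*n m (suc q′)
  ... | zero  | _   | m≡q*[m/q] = contradiction (ℕ.divides (m / suc q′) m≡q*[m/q]) q∤m
  ... | suc r | r<q | m≡r+q*[m/q] =
    ∣-resp-≡mod (∑-cong-mod (suc (suc q′)) reduce) (prime∣powerSum-small prime-p (suc r) (s≤s r<q))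
    where
    reduce : ∀ i → i < suc (suc q′) → (+ i) ^ m ≡ (+ i) ^ suc r mod + suc (suc q′)
    reduce i i<p = subst (λ e → (+ i) ^ e ≡ (+ i) ^ suc r mod + suc (suc q′)) (sym m≡r+q*[m/q])
                         (^-reduce-mod-prime prime-p i<p r (m / suc q′))

  ∑-odd-range : ∀ h → ∑[ t < suc (h ℕ.* 2) ] (+ t) ≡ + suc (h ℕ.* 2) * + h
  ∑-odd-range zero    = refl
  ∑-odd-range (suc h) = begin
    ∑[ t < suc (h ℕ.* 2) ] (+ t) + (1ℤ + x) + (1ℤ + (1ℤ + x))
      ≡⟨ cong (λ s → s + (1ℤ + x) + (1ℤ + (1ℤ + x))) (∑-odd-range h) ⟩
    (1ℤ + x) * + h + (1ℤ + x) + (1ℤ + (1ℤ + x))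
      ≡⟨ cong (λ x → (1ℤ + x) * + h + (1ℤ + x) + (1ℤ + (1ℤ + x))) (pos-* h 2) ⟩
    (1ℤ + + h * + 2) * + h + (1ℤ + + h * + 2) + (1ℤ + (1ℤ + + h * + 2))
      ≡⟨ gauss (+ h) ⟩
    (1ℤ + (1ℤ + (1ℤ + + h * + 2))) * (1ℤ + + h)
      ≡⟨ cong (λ x → (1ℤ + (1ℤ + (1ℤ + x))) * (1ℤ + + h)) (pos-* h 2) ⟨
    + suc (suc h ℕ.* 2) * + suc h
      ∎
    where
    open ≡-Reasoning
    x : ℤ
    x = + (h ℕ.* 2)
    gauss : ∀ h → (1ℤ + h * + 2) * h + (1ℤ + h * + 2) + (1ℤ + (1ℤ + h * + 2))
                  ≡ (1ℤ + (1ℤ + (1ℤ + h * + 2))) * (1ℤ + h)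
    gauss = solve-∀

  odd∣∑-range : ∀ {P} → ¬ (2 ℕ.∣ P) → + P ∣ ∑[ t < P ] (+ t)
  odd∣∑-range P-odd with odd⇒≡1+h*2 P-odd
  ... | h , refl = divides (+ h) (trans (∑-odd-range h) (*-comm (+ suc (h ℕ.* 2)) (+ h)))

  powerSum-lift : ∀ {P a} m → ¬ (2 ℕ.∣ P) → + P ∣ + a → + a ∣ powerSum (suc m) a →
                  + (P ℕ.* a) ∣ powerSum (suc m) (P ℕ.* a)
  powerSum-lift {P} {a} m P-odd (divides c a≡cP) a∣powerSum =
    subst (_∣ powerSum M (P ℕ.* a)) (sym (pos-* P a)) (∣-resp-≡mod expansion Pa∣expansion)
    where
    M : ℕ
    M = suc m
    E : ℤ
    E = + M * powerSum m a
    block : ∀ t r → (+ (t ℕ.* a ℕ.+ r)) ^ M ≡ (+ r) ^ M + + M * (+ r) ^ m * (+ t * + a) mod + P * + a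
    block t r = mod-∣ Pa∣[ta]²
      (mod-trans (mod-reflexive (cong (_^ M) position)) (binomial-mod-square (+ r) (+ t * + a) m))
      where
      position : + (t ℕ.* a ℕ.+ r) ≡ + r + + t * + a
      position = trans (pos-+ (t ℕ.* a) r)
                       (trans (+-comm (+ (t ℕ.* a)) (+ r)) (cong (_+_ (+ r)) (pos-* t a)))
      Pa∣[ta]² : + P * + a ∣ (+ t * + a) * (+ t * + a)
      Pa∣[ta]² = divides (+ t * + t * c)
        (trans (cong (λ z → (+ t * z) * (+ t * + a)) a≡cP) (reorder (+ t) c (+ P) (+ a)))
        where
        reorder : ∀ t c p a → (t * (c * p)) * (t * a) ≡ t * t * c * (p * a)
        reorder = solve-∀
    inner : ∀ t → ∑[ r < a ] ((+ r) ^ M + + M * (+ r) ^ m * (+ t * + a))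
                  ≡ powerSum M a + E * (+ t * + a)
    inner t = trans (∑-distrib-+ a _ _) (cong (_+_ (powerSum M a))
      (trans (sym (*-distribʳ-∑ (+ t * + a) a _))
             (cong (_* (+ t * + a)) (sym (*-distribˡ-∑ (+ M) a _)))))
    expansion : powerSum M (P ℕ.* a) ≡ + P * powerSum M a + E * + a * ∑[ t < P ] (+ t) mod + P * + a
    expansion = mod-trans (mod-reflexive (∑-blocks P a _))
      (mod-trans (∑-cong-mod P (λ t _ → ∑-cong-mod a (λ r _ → block t r)))
      (mod-reflexive (begin
        ∑[ t < P ] ∑[ r < a ] ((+ r) ^ M + + M * (+ r) ^ m * (+ t * + a))
          ≡⟨ ∑-cong P (λ t _ → inner t) ⟩
        ∑[ t < P ] (powerSum M a + E * (+ t * + a))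
          ≡⟨ ∑-distrib-+ P _ _ ⟩
        ∑[ t < P ] powerSum M a + ∑[ t < P ] (E * (+ t * + a))
          ≡⟨ cong₂ _+_ (∑-const P (powerSum M a)) (∑-cong P (λ t _ → regroup E (+ t) (+ a))) ⟩
        + P * powerSum M a + ∑[ t < P ] (E * + a * + t)
          ≡⟨ cong (_+_ (+ P * powerSum M a)) (*-distribˡ-∑ (E * + a) P (+_)) ⟨
        + P * powerSum M a + E * + a * ∑[ t < P ] (+ t)
          ∎)))
      where
      open ≡-Reasoning
      regroup : ∀ e t a → e * (t * a) ≡ e * a * t
      regroup = solve-∀
    Pa∣expansion : + P * + a ∣ + P * powerSum M a + E * + a * ∑[ t < P ] (+ t)
    Pa∣expansion with odd∣∑-range P-odd
    ... | divides d ∑≡dP = ∣m∣n⇒∣m+n (*-monoˡ-∣ (+ P) a∣powerSum)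
      (divides (E * d) (trans (cong (E * + a *_) ∑≡dP) (reorder E (+ a) d (+ P))))
      where
      reorder : ∀ e a d p → e * a * (d * p) ≡ e * d * (p * a)
      reorder = solve-∀

  powerSum-lift-^ : ∀ {p} m → ¬ (2 ℕ.∣ p) → + p ∣ powerSum (suc m) p →
                    ∀ α → + (p ℕ.^ suc α) ∣ powerSum (suc m) (p ℕ.^ suc α)
  powerSum-lift-^ {p} m p-odd p∣powerSum zero =
    subst (λ q → + q ∣ powerSum (suc m) q) (sym (ℕ.*-identityʳ p)) p∣powerSum
  powerSum-lift-^ {p} m p-odd p∣powerSum (suc α) =
    powerSum-lift m p-odd (divides (+ (p ℕ.^ α)) (trans (pos-* p (p ℕ.^ α)) (*-comm (+ p) _)))
                  (powerSum-lift-^ m p-odd p∣powerSum α)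

  ∣powerSum⇒∣powerSum-suc : ∀ {m n} → + n ∣ powerSum (suc m) n → + n ∣ powerSum (suc m) (suc n)
  ∣powerSum⇒∣powerSum-suc {m} {n} n∣powerSum =
    ∣m∣n⇒∣m+n n∣powerSum (divides ((+ n) ^ m) (*-comm (+ n) ((+ n) ^ m)))

  neg-^-even : ∀ x u → (- x) ^ (u ℕ.* 2) ≡ x ^ (u ℕ.* 2)
  neg-^-even x zero    = refl
  neg-^-even x (suc u) =
    trans (cong (λ y → - x * (- x * y)) (neg-^-even x u)) (square x (x ^ (u ℕ.* 2)))
    where
    square : ∀ x y → - x * (- x * y) ≡ x * (x * y)
    square = solve-∀

  powerSum-odd-symmetric : ∀ Q u → + Q ∣ powerSum (u ℕ.* 2) (suc Q) →
    + Q * + Q ∣ powerSum (suc (u ℕ.* 2)) (suc Q) + powerSum (suc (u ℕ.* 2)) (suc Q)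
  powerSum-odd-symmetric Q u (divides c T≡cQ) = ∣-resp-≡mod
    (mod-trans (mod-reflexive (begin
      T + T                                       ≡⟨ cong (_+_ T) (∑-reverse Q g) ⟩
      T + ∑[ i < suc Q ] g (Q ∸ i)                ≡⟨ ∑-distrib-+ (suc Q) g (λ i → g (Q ∸ i)) ⟨
      ∑[ i < suc Q ] (g i + g (Q ∸ i))            ∎))
    (mod-trans (∑-cong-mod (suc Q) (λ i i<1+Q → pair i (ℕ.≤-pred i<1+Q)))
               (mod-reflexive (sym (*-distribˡ-∑ K (suc Q) (λ i → (+ i) ^ (u ℕ.* 2)))))))
    (divides (+ k * c) (trans (cong (K *_) T≡cQ) (reorder (+ k) c (+ Q))))
    where
    open ≡-Reasoning
    k : ℕ
    k = suc (u ℕ.* 2)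
    K : ℤ
    K = + k * + Q
    g : ℕ → ℤ
    g i = (+ i) ^ k
    T : ℤ
    T = powerSum k (suc Q)
    reorder : ∀ k c q → k * q * (c * q) ≡ k * c * (q * q)
    reorder = solve-∀
    pair : ∀ i → i ≤ Q → g i + g (Q ∸ i) ≡ K * (+ i) ^ (u ℕ.* 2) mod + Q * + Q
    pair i i≤Q = mod-trans
      (+-cong-mod (mod-refl (g i))
        (mod-trans (mod-reflexive (cong (_^ k) reflection))
                   (binomial-mod-square (- + i) (+ Q) (u ℕ.* 2))))
      (mod-reflexive (trans (cong (λ y → g i + (- + i * y + + k * y * + Q)) (neg-^-even (+ i) u))
                            (cancel (+ i) ((+ i) ^ (u ℕ.* 2)) (+ k) (+ Q))))
      where
      reflection : + (Q ∸ i) ≡ - + i + + Q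
      reflection = sym (trans (+-comm (- + i) (+ Q)) (trans (m-n≡m⊖n Q i) (⊖-≥ i≤Q)))
      cancel : ∀ x y k q → x * y + (- x * y + k * y * q) ≡ k * q * y
      cancel = solve-∀

  pos-^ : ∀ a k → + (a ℕ.^ k) ≡ (+ a) ^ k
  pos-^ a zero    = refl
  pos-^ a (suc k) = trans (pos-* a (a ℕ.^ k)) (cong (+ a *_) (pos-^ a k))

  S≡powerSum : ∀ k n → + S (suc k) n ≡ powerSum (suc k) (suc n)
  S≡powerSum k zero    = refl
  S≡powerSum k (suc n) =
    trans (pos-+ (S (suc k) n) (suc n ℕ.^ suc k))
          (cong₂ _+_ (S≡powerSum k n) (pos-^ (suc n) (suc k)))

  square∣double-S : ∀ Q u → + Q ∣ powerSum (suc u ℕ.* 2) Q →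
                    Q ℕ.* Q ℕ.∣ 2 ℕ.* S (suc (suc u ℕ.* 2)) Q
  square∣double-S Q u Q∣powerSum = ∣⇒∣ᵤ (subst₂ _∣_ (sym (pos-* Q Q)) double
    (powerSum-odd-symmetric Q (suc u) (∣powerSum⇒∣powerSum-suc {suc (u ℕ.* 2)} Q∣powerSum)))
    where
    s : ℕ
    s = S (suc (suc u ℕ.* 2)) Q
    T : ℤ
    T = powerSum (suc (suc u ℕ.* 2)) (suc Q)
    double : T + T ≡ + (2 ℕ.* s)
    double = begin
      T + T                ≡⟨ cong₂ _+_ (S≡powerSum _ Q) (S≡powerSum _ Q) ⟨
      + s + + s            ≡⟨ pos-+ s s ⟨
      + (s ℕ.+ s)          ≡⟨ cong (λ t → + (s ℕ.+ t)) (ℕ.+-identityʳ s) ⟨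
      + (2 ℕ.* s)          ∎
      where open ≡-Reasoning

open import Defs
open import Data.Nat using (ℕ; zero; suc; _*_; _^_; _∸_; _≥_; s≤s)
open import Data.Nat.Properties using (*-identityʳ)
open import Data.Nat.Divisibility using (_∣_)
open import Data.Nat.Primality using (Prime)
open import Data.Nat.Coprimality using (coprime-divisor)
open import Data.Product using (_,_)
open import Relation.Binary.PropositionalEquality using (refl; sym; cong; subst)
open import Relation.Nullary using (¬_; contradiction)
open Parity using (odd⇒≡1+h*2; odd-*; odd-^; odd⇒coprime-2)
open PowerSums using (prime∣powerSum; powerSum-lift-^; square∣double-S)

theorem3p3 : (p α k : ℕ) → Prime p → ¬ (2 ∣ p) → α ≥ 1 → k ≥ 3 → ¬ (2 ∣ k) →
    ¬ ((p ∸ 1) ∣ (k ∸ 1)) → (p ^ α) ^ 2 ∣ S k (p ^ α)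
theorem3p3 p (suc α) k prime-p p-odd _ k≥3 k-odd p-1∤k-1 with odd⇒≡1+h*2 k-odd
... | zero  , refl = contradiction k≥3 λ { (s≤s ()) }
... | suc u , refl = subst (_∣ S k Q) (cong (Q *_) (sym (*-identityʳ Q)))
  (coprime-divisor (odd⇒coprime-2 (odd-* Q-odd Q-odd))
    (square∣double-S Q u (powerSum-lift-^ (suc (u * 2)) p-odd (prime∣powerSum prime-p p-1∤k-1) α)))
  where
  Q : ℕ
  Q = p ^ suc α
  Q-odd : ¬ (2 ∣ Q)
  Q-odd = odd-^ p-odd (suc α)
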